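{- Let $R$ be a commutative ring, let $n \geq 1$, let $A$ be an $n \times 3$ matrix over $R$ and let $B$ be a $3 \times 3$ matrix over $R$. Then the product $AB$ can be computed using $6n+3$ multiplications.
   Context: "Computed using $k$ multiplications" means: there are $k$ products $q_1,\dots,q_k$, each of the form $q_t = L_t \cdot L'_t$ where $L_t, L'_t$ are linear combinations with integer coefficients of the entries of $A$ and of $B$ (entries of $A$ and $B$ may be mixed within one factor, which is allowed because $R$ is commutative), such that every entry of $AB$ equals an integer linear combination of $q_1,\dots,q_k$, identically for all matrices $A$, $B$ of the given sizes over $R$. Only these $k$ ring multiplications are counted; additions, subtractions and multiplications by integer constants are not counted. -}

module Defs where

open import Algebra.Bundles using (CommutativeRing)
open import Data.Nat using (ℕ; zero; suc) renaming (_+_ to _+ℕ_)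
open import Data.Integer using (ℤ; +_; -[1+_])
open import Data.Fin using (Fin; zero; suc)
open import Data.Product using (_×_; _,_)
open import Data.Sum using (_⊎_; inj₁; inj₂)
open import Level using (_⊔_)

Var : ℕ → Set
Var n = (Fin n × Fin 3) ⊎ (Fin 3 × Fin 3)

LinForm : ℕ → Set
LinForm n = Var n → ℤ

-- A (commutative) algorithm for the n×3 by 3×3 product using k multiplications:
-- products q_t = L_t · L'_t (t < k), and each entry (AB)_{ij} is the integer
-- combination  Σ_t coeff i j t · q_t.
record Algorithm (n k : ℕ) : Set where
  field
    left  : Fin k → LinForm n
    right : Fin k → LinForm n
    coeff : Fin n → Fin 3 → Fin k → ℤ

module _ {c ℓ} (R : CommutativeRing c ℓ) where
  open CommutativeRing R using (Carrier; _≈_; _+_; _*_; -_; 0#; 1#)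

  ℕ→R : ℕ → Carrier
  ℕ→R zero    = 0#
  ℕ→R (suc m) = 1# + ℕ→R m

  ℤ→R : ℤ → Carrier
  ℤ→R (+ m)     = ℕ→R m
  ℤ→R -[1+ m ]  = - (ℕ→R (suc m))

  ∑ : (m : ℕ) → (Fin m → Carrier) → Carrier
  ∑ zero    f = 0#
  ∑ (suc m) f = f zero + ∑ m (λ i → f (suc i))

  evalLin : {n : ℕ} → (Fin n → Fin 3 → Carrier) → (Fin 3 → Fin 3 → Carrier)
          → LinForm n → Carrier
  evalLin {n} A B L =
    ∑ n (λ i → ∑ 3 (λ j → ℤ→R (L (inj₁ (i , j))) * A i j))
    + ∑ 3 (λ i → ∑ 3 (λ j → ℤ→R (L (inj₂ (i , j))) * B i j))

  Computes : {n k : ℕ} → Algorithm n k → Set (c ⊔ ℓ)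
  Computes {n} {k} alg =
    (A : Fin n → Fin 3 → Carrier) (B : Fin 3 → Fin 3 → Carrier) →
    (i : Fin n) (j : Fin 3) →
    ∑ 3 (λ l → A i l * B l j)
      ≈ ∑ k (λ t → ℤ→R (Algorithm.coeff alg i j t)
                    * (evalLin A B (Algorithm.left alg t)
                       * evalLin A B (Algorithm.right alg t)))

-- Row i of AB is the row a = A i times B, so it suffices to compute a·B for one row a.
-- The three products (a₀ − b₁₂)(a₁ − b₀₁), (a₀ − b₂₂)(a₂ − b₀₀), (a₁ − b₂₁)(a₂ − b₁₀)
-- contain the wanted terms a_x b_xl together with junk of two kinds: products a_x a_y,
-- which three further products (a_x + a_y + ⋯) a_z cancel (this is where commutativity
-- is used), and products of two entries of B, which do not depend on the row. Those three
-- products of entries of B are computed once for all rows, giving 6 per row plus 3.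
module Submission where

open import Algebra.Bundles using (CommutativeRing)
open import Algebra.Solver.Ring.AlmostCommutativeRing
  using (_-Raw-AlmostCommutative⟶_; fromCommutativeRing)
import Algebra.Solver.Ring as RingSolver
open import Data.Fin using (Fin; zero; suc; _≟_; _↑ˡ_; _↑ʳ_; splitAt; remQuot; quotRem; combine)
open import Data.Fin.Patterns using (0F; 1F; 2F)
open import Data.Fin.Properties using (suc-injective)
open import Data.Bool using (if_then_else_)
open import Data.Integer as ℤ using (ℤ; +_; -[1+_]; 0ℤ; 1ℤ; -1ℤ)
import Data.Integer.Properties as ℤP
open import Data.Maybe using (Maybe) renaming (map to mapMaybe)
open import Data.Nat as ℕ using (ℕ; zero; suc; _≤_)
open import Data.Product as Product using (Σ; _×_; _,_; uncurry; swap)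
open import Data.Sum as Sum using (_⊎_; inj₁; inj₂; [_,_]′)
open import Data.Vec using (Vec; tabulate)
open import Data.Vec.Functional using ([]; _∷_)
open import Function using (_∘_)
open import Level using (_⊔_)
open import Relation.Binary.PropositionalEquality as ≡ using (_≡_; _≢_)
open import Relation.Nullary using (does)
open import Relation.Nullary.Decidable using (dec-true; dec-false; dec⇒maybe)

open import Defs

module CanonicalMap {c ℓ} (R : CommutativeRing c ℓ) where
  open CommutativeRing R hiding (zero)
  open import Algebra.Properties.Ring ring using (-‿involutive; -‿distribˡ-*; -0#≈0#)
  open import Relation.Binary.Reasoning.Setoid setoid
  open import Algebra.Properties.AbelianGroup +-abelianGroup using (xyx⁻¹≈y; ⁻¹-∙-comm)

  ℕ→R-+ : ∀ m n → ℕ→R R (m ℕ.+ n) ≈ ℕ→R R m + ℕ→R R n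
  ℕ→R-+ zero    n = sym (+-identityˡ _)
  ℕ→R-+ (suc m) n = trans (+-congˡ (ℕ→R-+ m n)) (sym (+-assoc _ _ _))

  ℤ→R-⊖ : ∀ m n → ℤ→R R (m ℤ.⊖ n) ≈ ℕ→R R m - ℕ→R R n
  ℤ→R-⊖ m       zero    = begin
    ℤ→R R (m ℤ.⊖ 0)  ≡⟨ ≡.cong (ℤ→R R) (ℤP.⊖-≥ {m} ℕ.z≤n) ⟩
    ℕ→R R m          ≈⟨ +-identityʳ _ ⟨
    ℕ→R R m + 0#     ≈⟨ +-congˡ -0#≈0# ⟨
    ℕ→R R m - 0#     ∎
  ℤ→R-⊖ zero    (suc n) = sym (+-identityˡ _)
  ℤ→R-⊖ (suc m) (suc n) = begin
    ℤ→R R (suc m ℤ.⊖ suc n)                ≡⟨ ≡.cong (ℤ→R R) (ℤP.[1+m]⊖[1+n]≡m⊖n m n) ⟩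
    ℤ→R R (m ℤ.⊖ n)                        ≈⟨ ℤ→R-⊖ m n ⟩
    ℕ→R R m - ℕ→R R n                      ≈⟨ +-congʳ (xyx⁻¹≈y 1# (ℕ→R R m)) ⟨
    (1# + ℕ→R R m) + - 1# + - ℕ→R R n      ≈⟨ +-assoc _ _ _ ⟩
    (1# + ℕ→R R m) + (- 1# + - ℕ→R R n)    ≈⟨ +-congˡ (⁻¹-∙-comm _ _) ⟩
    ℕ→R R (suc m) - ℕ→R R (suc n)          ∎

  ℤ→R-+ : ∀ x y → ℤ→R R (x ℤ.+ y) ≈ ℤ→R R x + ℤ→R R y
  ℤ→R-+ (+ m)    (+ n)    = ℕ→R-+ m n
  ℤ→R-+ (+ m)    -[1+ n ] = ℤ→R-⊖ m (suc n)
  ℤ→R-+ -[1+ m ] (+ n)    = trans (ℤ→R-⊖ n (suc m)) (+-comm _ _)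
  ℤ→R-+ -[1+ m ] -[1+ n ] = begin
    ℤ→R R (-[1+ m ] ℤ.+ -[1+ n ])
      ≡⟨ ≡.cong (ℤ→R R) (ℤP.neg-distrib-+ (+ suc m) (+ suc n)) ⟨
    ℤ→R R (ℤ.- (+ suc m ℤ.+ + suc n))      ≈⟨ -‿cong (ℕ→R-+ (suc m) (suc n)) ⟩
    - (ℕ→R R (suc m) + ℕ→R R (suc n))      ≈⟨ ⁻¹-∙-comm _ _ ⟨
    - ℕ→R R (suc m) + - ℕ→R R (suc n)      ∎

  ℤ→R-neg : ∀ x → ℤ→R R (ℤ.- x) ≈ - ℤ→R R x
  ℤ→R-neg (+ zero)  = sym -0#≈0#
  ℤ→R-neg (+ suc n) = refl
  ℤ→R-neg -[1+ n ]  = sym (-‿involutive _)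

  ℤ→R-*-+ : ∀ m y → ℤ→R R (+ m ℤ.* y) ≈ ℕ→R R m * ℤ→R R y
  ℤ→R-*-+ zero    y = sym (zeroˡ _)
  ℤ→R-*-+ (suc m) y = begin
    ℤ→R R (+ suc m ℤ.* y)                 ≡⟨ ≡.cong (ℤ→R R) (ℤP.suc-* (+ m) y) ⟩
    ℤ→R R (y ℤ.+ + m ℤ.* y)               ≈⟨ ℤ→R-+ y (+ m ℤ.* y) ⟩
    ℤ→R R y + ℤ→R R (+ m ℤ.* y)           ≈⟨ +-cong (sym (*-identityˡ _)) (ℤ→R-*-+ m y) ⟩
    1# * ℤ→R R y + ℕ→R R m * ℤ→R R y      ≈⟨ distribʳ _ _ _ ⟨
    ℕ→R R (suc m) * ℤ→R R y               ∎

  ℤ→R-* : ∀ x y → ℤ→R R (x ℤ.* y) ≈ ℤ→R R x * ℤ→R R y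
  ℤ→R-* (+ m)    y = ℤ→R-*-+ m y
  ℤ→R-* -[1+ m ] y = begin
    ℤ→R R (-[1+ m ] ℤ.* y)                ≡⟨ ≡.cong (ℤ→R R) (ℤP.neg-distribˡ-* (+ suc m) y) ⟨
    ℤ→R R (ℤ.- (+ suc m ℤ.* y))           ≈⟨ ℤ→R-neg (+ suc m ℤ.* y) ⟩
    - ℤ→R R (+ suc m ℤ.* y)               ≈⟨ -‿cong (ℤ→R-*-+ (suc m) y) ⟩
    - (ℕ→R R (suc m) * ℤ→R R y)           ≈⟨ -‿distribˡ-* _ _ ⟩
    - ℕ→R R (suc m) * ℤ→R R y             ∎

  ℤ→R-homomorphism : ℤ.+-*-rawRing -Raw-AlmostCommutative⟶ fromCommutativeRing R
  ℤ→R-homomorphism = record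
    { ⟦_⟧    = ℤ→R R
    ; +-homo = ℤ→R-+
    ; *-homo = ℤ→R-*
    ; -‿homo = ℤ→R-neg
    ; 0-homo = refl
    ; 1-homo = +-identityʳ 1#
    }

module Sums {c ℓ} (R : CommutativeRing c ℓ) where
  open CommutativeRing R hiding (zero)

  ∑-cong : ∀ m {f g : Fin m → Carrier} → (∀ x → f x ≈ g x) → ∑ R m f ≈ ∑ R m g
  ∑-cong zero    f≈g = refl
  ∑-cong (suc m) f≈g = +-cong (f≈g zero) (∑-cong m (f≈g ∘ suc))

  ∑-zero : ∀ m {f : Fin m → Carrier} → (∀ x → f x ≈ 0#) → ∑ R m f ≈ 0#
  ∑-zero zero    f≈0 = refl
  ∑-zero (suc m) f≈0 = trans (+-cong (f≈0 zero) (∑-zero m (f≈0 ∘ suc))) (+-identityˡ 0#)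

  ∑-select : ∀ m (i : Fin m) (f : Fin m → Carrier) → (∀ x → x ≢ i → f x ≈ 0#) → ∑ R m f ≈ f i
  ∑-select (suc m) zero    f f≈0 =
    trans (+-congˡ (∑-zero m (λ x → f≈0 (suc x) λ ()))) (+-identityʳ _)
  ∑-select (suc m) (suc i) f f≈0 =
    trans (+-cong (f≈0 zero λ ())
                  (∑-select m i (f ∘ suc) (λ x x≢i → f≈0 (suc x) (x≢i ∘ suc-injective))))
          (+-identityˡ _)

  ∑-splitAt : ∀ m k (f : Fin m ⊎ Fin k → Carrier) →
              ∑ R (m ℕ.+ k) (f ∘ splitAt m) ≈ ∑ R m (f ∘ inj₁) + ∑ R k (f ∘ inj₂)
  ∑-splitAt zero    k f = sym (+-identityˡ _)
  ∑-splitAt (suc m) k f = trans (+-congˡ (∑-splitAt m k (f ∘ Sum.map₁ suc))) (sym (+-assoc _ _ _))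

  ∑-remQuot : ∀ m n (f : Fin m × Fin n → Carrier) →
              ∑ R (m ℕ.* n) (f ∘ remQuot n) ≈ ∑ R m (λ i → ∑ R n (λ j → f (i , j)))
  ∑-remQuot zero    n f = refl
  -- remQuot {suc m} n unfolds to the function composed with splitAt n below.
  ∑-remQuot (suc m) n f =
    trans (∑-splitAt n (m ℕ.* n) (f ∘ swap ∘ [ (_, zero) , Product.map₂ suc ∘ quotRem n ]′))
          (+-congˡ (∑-remQuot m n (f ∘ Product.map₁ suc)))

MatForm : Set
MatForm = Fin 3 × Fin 3 → ℤ

RowForm : Set
RowForm = (Fin 3 → ℤ) × MatForm

record RowScheme (p q : ℕ) : Set where
  field
    left right             : Fin p → RowForm
    sharedLeft sharedRight : Fin q → MatForm
    coeff                  : Fin 3 → Fin p → ℤ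
    sharedCoeff            : Fin 3 → Fin q → ℤ

onlyAt : ∀ {n} → Fin n → ℤ → Fin n → ℤ
onlyAt i z x = if does (x ≟ i) then z else 0ℤ

onlyAt-self : ∀ {n} (i : Fin n) z → onlyAt i z i ≡ z
onlyAt-self i z = ≡.cong (if_then z else 0ℤ) (dec-true (i ≟ i) ≡.refl)

onlyAt-other : ∀ {n} {i x : Fin n} z → x ≢ i → onlyAt i z x ≡ 0ℤ
onlyAt-other {i = i} {x} z x≢i = ≡.cong (if_then z else 0ℤ) (dec-false (x ≟ i) x≢i)

atRow : ∀ {n} → Fin n → RowForm → LinForm n
atRow i (ℓ , M) (inj₁ (x , j)) = onlyAt i (ℓ j) x
atRow i (ℓ , M) (inj₂ v)       = M v

onMatrix : ∀ {n} → MatForm → LinForm n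
onMatrix M (inj₁ _) = 0ℤ
onMatrix M (inj₂ v) = M v

decode : ∀ p q n → Fin (p ℕ.* n ℕ.+ q) → (Fin p × Fin n) ⊎ Fin q
decode p q n t = Sum.map₁ (remQuot n) (splitAt (p ℕ.* n) t)

module _ {p q : ℕ} (S : RowScheme p q) {n : ℕ} where
  open RowScheme S

  leftForm rightForm : (Fin p × Fin n) ⊎ Fin q → LinForm n
  leftForm  (inj₁ (s , i)) = atRow i (left s)
  leftForm  (inj₂ s)       = onMatrix (sharedLeft s)
  rightForm (inj₁ (s , i)) = atRow i (right s)
  rightForm (inj₂ s)       = onMatrix (sharedRight s)

  outputCoeff : Fin n → Fin 3 → (Fin p × Fin n) ⊎ Fin q → ℤ
  outputCoeff i j (inj₁ (s , x)) = onlyAt i (coeff j s) x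
  outputCoeff i j (inj₂ s)       = sharedCoeff j s

toAlgorithm : ∀ {p q} → RowScheme p q → (n : ℕ) → Algorithm n (p ℕ.* n ℕ.+ q)
toAlgorithm {p} {q} S n = record
  { left  = leftForm S ∘ decode p q n
  ; right = rightForm S ∘ decode p q n
  ; coeff = λ i j → outputCoeff S i j ∘ decode p q n
  }

module Evaluation {c ℓ} (R : CommutativeRing c ℓ) where
  open CommutativeRing R hiding (zero)
  open Sums R

  evalMat : (Fin 3 → Fin 3 → Carrier) → MatForm → Carrier
  evalMat B M = ∑ R 3 (λ k → ∑ R 3 (λ j → ℤ→R R (M (k , j)) * B k j))

  evalRow : (Fin 3 → Carrier) → (Fin 3 → Fin 3 → Carrier) → RowForm → Carrier
  evalRow a B (ℓ , M) = ∑ R 3 (λ j → ℤ→R R (ℓ j) * a j) + evalMat B M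

  ComputesRow : ∀ {p q} → RowScheme p q → Set (c ⊔ ℓ)
  ComputesRow {p} {q} S =
    (a : Fin 3 → Carrier) (B : Fin 3 → Fin 3 → Carrier) (j : Fin 3) →
    ∑ R 3 (λ l → a l * B l j)
      ≈ ∑ R p (λ s → ℤ→R R (coeff j s) * (evalRow a B (left s) * evalRow a B (right s)))
        + ∑ R q (λ s → ℤ→R R (sharedCoeff j s)
                         * (evalMat B (sharedLeft s) * evalMat B (sharedRight s)))
    where open RowScheme S

  module _ {n : ℕ} (A : Fin n → Fin 3 → Carrier) (B : Fin 3 → Fin 3 → Carrier) where

    evalLin-atRow : ∀ i L → evalLin R A B (atRow i L) ≈ evalRow (A i) B L
    evalLin-atRow i (ℓ , M) = +-congʳ (trans (∑-select n i _ rowVanishes) (∑-cong 3 onRow))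
      where
      rowVanishes : ∀ x → x ≢ i → ∑ R 3 (λ j → ℤ→R R (onlyAt i (ℓ j) x) * A x j) ≈ 0#
      rowVanishes x x≢i = ∑-zero 3 (λ j →
        trans (*-congʳ (reflexive (≡.cong (ℤ→R R) (onlyAt-other (ℓ j) x≢i)))) (zeroˡ (A x j)))
      onRow : ∀ j → ℤ→R R (onlyAt i (ℓ j) i) * A i j ≈ ℤ→R R (ℓ j) * A i j
      onRow j = *-congʳ {A i j} (reflexive (≡.cong (ℤ→R R) (onlyAt-self i (ℓ j))))

    evalLin-onMatrix : ∀ M → evalLin R A B (onMatrix M) ≈ evalMat B M
    evalLin-onMatrix M =
      trans (+-congʳ (∑-zero n (λ x → ∑-zero 3 (λ j → zeroˡ (A x j))))) (+-identityˡ _)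

  ∑-decode : ∀ p q n (f : (Fin p × Fin n) ⊎ Fin q → Carrier) →
             ∑ R (p ℕ.* n ℕ.+ q) (f ∘ decode p q n)
               ≈ ∑ R p (λ s → ∑ R n (λ x → f (inj₁ (s , x)))) + ∑ R q (f ∘ inj₂)
  ∑-decode p q n f =
    trans (∑-splitAt (p ℕ.* n) q (f ∘ Sum.map₁ (remQuot n))) (+-congʳ (∑-remQuot p n (f ∘ inj₁)))

  toAlgorithm-computes : ∀ {p q} (S : RowScheme p q) → ComputesRow S →
                         ∀ n → Computes R (toAlgorithm S n)
  toAlgorithm-computes {p} {q} S S-computes n A B i j =
    sym (trans (∑-decode p q n product)
               (trans (+-cong (∑-cong p rowProducts) (∑-cong q sharedProducts))
                      (sym (S-computes (A i) B j))))
    where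
    open RowScheme S

    product : (Fin p × Fin n) ⊎ Fin q → Carrier
    product t = ℤ→R R (outputCoeff S i j t)
                * (evalLin R A B (leftForm S t) * evalLin R A B (rightForm S t))

    rowProducts : ∀ s → ∑ R n (λ x → product (inj₁ (s , x)))
                        ≈ ℤ→R R (coeff j s) * (evalRow (A i) B (left s) * evalRow (A i) B (right s))
    rowProducts s = trans (∑-select n i _ vanishes)
      (*-cong (reflexive (≡.cong (ℤ→R R) (onlyAt-self i (coeff j s))))
              (*-cong (evalLin-atRow A B i (left s)) (evalLin-atRow A B i (right s))))
      where
      vanishes : ∀ x → x ≢ i → product (inj₁ (s , x)) ≈ 0#
      vanishes x x≢i =
        trans (*-congʳ (reflexive (≡.cong (ℤ→R R) (onlyAt-other (coeff j s) x≢i)))) (zeroˡ _)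

    sharedProducts : ∀ s → product (inj₂ s)
                           ≈ ℤ→R R (sharedCoeff j s)
                             * (evalMat B (sharedLeft s) * evalMat B (sharedRight s))
    sharedProducts s = *-congˡ (*-cong (evalLin-onMatrix A B (sharedLeft s))
                                       (evalLin-onMatrix A B (sharedRight s)))

infixl 6 _⊕_ _⊖_
infix  8 ⊖_

_⊕_ _⊖_ : {V : Set} → (V → ℤ) → (V → ℤ) → V → ℤ
(f ⊕ g) v = f v ℤ.+ g v
(f ⊖ g) v = f v ℤ.- g v

⊖_ : {V : Set} → (V → ℤ) → V → ℤ
(⊖ f) v = ℤ.- f v

𝟘 : {V : Set} → V → ℤ
𝟘 _ = 0ℤ

𝕒 : Fin 3 → Fin 3 → ℤ
𝕒 l = onlyAt l 1ℤ

𝕓 : Fin 3 → Fin 3 → MatForm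
𝕓 k l (k′ , l′) = onlyAt k 1ℤ k′ ℤ.* onlyAt l 1ℤ l′

commutativeRowScheme : RowScheme 6 3
commutativeRowScheme = record
  { left        = (𝕒 0F , ⊖ 𝕓 1F 2F)
                ∷ (𝕒 0F , ⊖ 𝕓 2F 2F)
                ∷ (𝕒 1F , ⊖ 𝕓 2F 1F)
                ∷ (𝕒 0F ⊕ 𝕒 1F , 𝕓 2F 0F ⊖ 𝕓 2F 1F ⊖ 𝕓 2F 2F)
                ∷ (𝕒 0F ⊕ 𝕒 2F , 𝕓 1F 1F ⊖ 𝕓 1F 0F ⊖ 𝕓 1F 2F)
                ∷ (𝕒 1F ⊕ 𝕒 2F , 𝕓 0F 2F ⊖ 𝕓 0F 0F ⊖ 𝕓 0F 1F)
                ∷ []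
  ; right       = (𝕒 1F , ⊖ 𝕓 0F 1F)
                ∷ (𝕒 2F , ⊖ 𝕓 0F 0F)
                ∷ (𝕒 2F , ⊖ 𝕓 1F 0F)
                ∷ (𝕒 2F , 𝟘)
                ∷ (𝕒 1F , 𝟘)
                ∷ (𝕒 0F , 𝟘)
                ∷ []
  ; sharedLeft  = 𝕓 1F 2F ∷ 𝕓 2F 2F ∷ 𝕓 2F 1F ∷ []
  ; sharedRight = 𝕓 0F 1F ∷ 𝕓 0F 0F ∷ 𝕓 1F 0F ∷ []
  ; coeff       = (0ℤ  ∷ -1ℤ ∷ -1ℤ ∷ 1ℤ ∷ 0ℤ ∷ 0ℤ ∷ [])
                ∷ (-1ℤ ∷ 0ℤ  ∷ -1ℤ ∷ 0ℤ ∷ 1ℤ ∷ 0ℤ ∷ [])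
                ∷ (-1ℤ ∷ -1ℤ ∷ 0ℤ  ∷ 0ℤ ∷ 0ℤ ∷ 1ℤ ∷ [])
                ∷ []
  ; sharedCoeff = (0ℤ ∷ 1ℤ ∷ 1ℤ ∷ [])
                ∷ (1ℤ ∷ 0ℤ ∷ 1ℤ ∷ [])
                ∷ (1ℤ ∷ 1ℤ ∷ 0ℤ ∷ [])
                ∷ []
  }

module PolynomialIdentity {c ℓ} (R : CommutativeRing c ℓ) where
  open CommutativeRing R hiding (zero)
  open Evaluation R using (ComputesRow)

  ℤ→R-≟ : ∀ x y → Maybe (ℤ→R R x ≈ ℤ→R R y)
  ℤ→R-≟ x y = mapMaybe (reflexive ∘ ≡.cong (ℤ→R R)) (dec⇒maybe (x ℤ.≟ y))

  open RingSolver ℤ.+-*-rawRing (fromCommutativeRing R) (CanonicalMap.ℤ→R-homomorphism R) ℤ→R-≟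
    using (Polynomial; con; var; _:+_; _:*_; prove)

  aVar : Fin 3 → Fin 12
  aVar l = l ↑ˡ 9

  bVar : Fin 3 → Fin 3 → Fin 12
  bVar k l = 3 ↑ʳ combine k l

  env : (Fin 3 → Carrier) → (Fin 3 → Fin 3 → Carrier) → Vec Carrier 12
  env a B = tabulate ([ a , uncurry B ∘ remQuot {3} 3 ]′ ∘ splitAt 3)

  ∑ᴾ : (m : ℕ) → (Fin m → Polynomial 12) → Polynomial 12
  ∑ᴾ zero    f = con 0ℤ
  ∑ᴾ (suc m) f = f zero :+ ∑ᴾ m (f ∘ suc)

  matPoly : MatForm → Polynomial 12
  matPoly M = ∑ᴾ 3 (λ k → ∑ᴾ 3 (λ l → con (M (k , l)) :* var (bVar k l)))

  rowPoly : RowForm → Polynomial 12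
  rowPoly (ℓ , M) = ∑ᴾ 3 (λ l → con (ℓ l) :* var (aVar l)) :+ matPoly M

  entryPoly : Fin 3 → Polynomial 12
  entryPoly j = ∑ᴾ 3 (λ l → var (aVar l) :* var (bVar l j))

  schemePoly : ∀ {p q} → RowScheme p q → Fin 3 → Polynomial 12
  schemePoly {p} {q} S j =
    ∑ᴾ p (λ s → con (coeff j s) :* (rowPoly (left s) :* rowPoly (right s)))
    :+ ∑ᴾ q (λ s → con (sharedCoeff j s) :* (matPoly (sharedLeft s) :* matPoly (sharedRight s)))
    where open RowScheme S

  -- At env a B the semantics of entryPoly j and of schemePoly S j unfold definitionally
  -- to the two sides of ComputesRow S, so prove yields ComputesRow directly.

  commutativeRowScheme-computes : ComputesRow commutativeRowScheme
  commutativeRowScheme-computes a B 0F =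
    prove (env a B) (entryPoly 0F) (schemePoly commutativeRowScheme 0F) refl
  commutativeRowScheme-computes a B 1F =
    prove (env a B) (entryPoly 1F) (schemePoly commutativeRowScheme 1F) refl
  commutativeRowScheme-computes a B 2F =
    prove (env a B) (entryPoly 2F) (schemePoly commutativeRowScheme 2F) refl

-- Imported only here because above, _+_ and _*_ are the operations of the ring.
open import Data.Nat using (_+_; _*_)

mainTheorem1 : ∀ {c ℓ} (R : CommutativeRing c ℓ) (n : ℕ) → 1 ≤ n →
    Σ (Algorithm n (6 * n + 3)) (λ alg → Computes R alg)
mainTheorem1 R n _ =
  toAlgorithm commutativeRowScheme n ,
  Evaluation.toAlgorithm-computes R commutativeRowScheme
    (PolynomialIdentity.commutativeRowScheme-computes R) n
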